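{- Let $H$ be a bipartite graph with no vertex of degree zero or one, with vertex set $S\uplus T$, $S=\{1,\dots,n\}$, $T=\{n+1,\dots,n+m\}$. Then the matching map $\psi:\mathcal{V}(H)\to\mathcal{M}(H)$ is well defined (i.e., $\psi(\mathbf{a})$ is a matching of $W(H)$ for every clique vector $\mathbf{a}$) and is a bijection.
   Context: Every edge of $H$ joins a vertex of $S$ to a vertex of $T$; $N_H(v)$ is the neighborhood of $v$. A clique vector is $\mathbf{a}=((a_v)_{v\in S\cup T},(a_{i,j})_{ij\in E(H)})$ with $a_v\in N_H(v)$ for every vertex $v$ and $a_{i,j}\in\{+,-\}$, where $a_{i,j}$ may equal $+$ only if $a_i=j$ and $a_j=i$ (otherwise $a_{i,j}=-$); here edges are written $ij$ with $i\in S$, $j\in T$. $\mathcal{V}(H)$ is the set of clique vectors. The almost-degree-whiskered graph $W(H)$ is obtained from $H$ by adding pendant vertices as follows: if $v$ has neighbors $v_1<v_2<\dots<v_k$ in $H$, then $v$ receives new neighbors $w_{v,v_2},\dots,w_{v,v_k}$ if $v\in S$, and $w_{v,v_1},\dots,w_{v,v_{k-1}}$ if $v\in T$, each new vertex adjacent only to $v$. $\mathcal{M}(H)$ is the set of matchings of $W(H)$ (including the empty one). The matching map $\psi$ sends $\mathbf{a}$ to the set of edges of $W(H)$ obtained by including: (1) for $i\in S$ with $a_i=j$ and $a_j\ne i$, the edge $iw_{i,j}$ if it exists; (2) for $j\in T$ with $a_j=i$ and $a_i\ne j$, the edge $jw_{j,i}$ if it exists; (3) for $a_i=j$, $a_j=i$,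 $a_{i,j}=-$, the edge $ij$; (4) for $a_i=j$, $a_j=i$, $a_{i,j}=+$, the edges $iw_{i,j}$ and $jw_{j,i}$, each only if it exists. -}

module Defs where

open import Data.Nat using (ℕ; _≤_; _<ᵇ_)
open import Data.Fin using (Fin; toℕ; _≟_)
open import Data.Bool using (Bool; true; false; T; _∧_; _∨_; not; if_then_else_)
open import Data.List using (List; length; filterᵇ; allFin)
open import Data.Bool.ListAction using (any)
open import Data.Product using (_×_; _,_)
open import Relation.Binary.PropositionalEquality using (_≡_)
open import Relation.Nullary.Decidable using (⌊_⌋)

-- A bipartite graph H on S ⊎ T with S = {1..n} (as Fin n) and T = {n+1..n+m}
-- (as Fin m, vertex n+1+k represented by k : Fin m; the order on T is the order on Fin m).
BipAdj : ℕ → ℕ → Set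
BipAdj n m = Fin n → Fin m → Bool

module _ {n m : ℕ} (adj : BipAdj n m) where

  degS : Fin n → ℕ
  degS i = length (filterᵇ (λ j → adj i j) (allFin m))

  degT : Fin m → ℕ
  degT j = length (filterᵇ (λ i → adj i j) (allFin n))

  NoDeg01 : Set
  NoDeg01 = (∀ i → 2 ≤ degS i) × (∀ j → 2 ≤ degT j)

  data Sign : Set where
    plus minus : Sign

  isPlus : Sign → Bool
  isPlus plus = true
  isPlus minus = false

  isMinus : Sign → Bool
  isMinus s = not (isPlus s)

  -- clique vectors  a = ((a_v)_v, (a_{i,j})_{ij ∈ E(H)})
  record CliqueVec : Set where
    field
      aS    : Fin n → Fin m
      aS-nb : ∀ i → T (adj i (aS i))
      aT    : Fin m → Fin n
      aT-nb : ∀ j → T (adj (aT j) j)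
      sgn   : (i : Fin n) (j : Fin m) → T (adj i j) → Sign
      sgn-ok : ∀ i j (e : T (adj i j)) → sgn i j e ≡ plus → (aS i ≡ j × aT j ≡ i)
  open CliqueVec public

  _≈V_ : CliqueVec → CliqueVec → Set
  a ≈V b = (∀ i → aS a i ≡ aS b i) × (∀ j → aT a j ≡ aT b j)
         × (∀ i j (e : T (adj i j)) → sgn a i j e ≡ sgn b i j e)

  -- Whisker existence in W(H):
  -- for i ∈ S, w_{i,j} exists iff j ∈ N_H(i) and j is not the smallest neighbour of i;
  -- for j ∈ T, w_{j,i} exists iff i ∈ N_H(j) and i is not the largest neighbour of j.
  hasSmallerNbrS : Fin n → Fin m → Bool
  hasSmallerNbrS i j = any (λ j' → (toℕ j' <ᵇ toℕ j) ∧ adj i j') (allFin m)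

  hasLargerNbrT : Fin m → Fin n → Bool
  hasLargerNbrT j i = any (λ i' → (toℕ i <ᵇ toℕ i') ∧ adj i' j) (allFin n)

  data WVert : Set where
    sV  : Fin n → WVert
    tV  : Fin m → WVert
    wSV : Fin n → Fin m → WVert
    wTV : Fin m → Fin n → WVert

  data WEdge : Set where
    hE  : (i : Fin n) (j : Fin m) → T (adj i j) → WEdge
    wsE : (i : Fin n) (j : Fin m) → T (adj i j) → T (hasSmallerNbrS i j) → WEdge
    wtE : (j : Fin m) (i : Fin n) → T (adj i j) → T (hasLargerNbrT j i) → WEdge

  data Incident : WVert → WEdge → Set where
    hE-s  : ∀ {i j e} → Incident (sV i) (hE i j e)
    hE-t  : ∀ {i j e} → Incident (tV j) (hE i j e)
    wsE-s : ∀ {i j e h} → Incident (sV i) (wsE i j e h)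
    wsE-w : ∀ {i j e h} → Incident (wSV i j) (wsE i j e h)
    wtE-t : ∀ {j i e h} → Incident (tV j) (wtE j i e h)
    wtE-w : ∀ {j i e h} → Incident (wTV j i) (wtE j i e h)

  EdgeSet : Set
  EdgeSet = WEdge → Bool

  IsMatching : EdgeSet → Set
  IsMatching M = ∀ e f v → T (M e) → T (M f) → Incident v e → Incident v f → e ≡ f

  _==S_ : Fin n → Fin n → Bool
  x ==S y = ⌊ x ≟ y ⌋

  _==T_ : Fin m → Fin m → Bool
  x ==T y = ⌊ x ≟ y ⌋

  ψ : CliqueVec → EdgeSet
  ψ a (hE i j e) = (aS a i ==T j) ∧ (aT a j ==S i) ∧ isMinus (sgn a i j e)
  ψ a (wsE i j e _) =
      ((aS a i ==T j) ∧ not (aT a j ==S i))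
    ∨ ((aS a i ==T j) ∧ (aT a j ==S i) ∧ isPlus (sgn a i j e))
  ψ a (wtE j i e _) =
      ((aT a j ==S i) ∧ not (aS a i ==T j))
    ∨ ((aS a i ==T j) ∧ (aT a j ==S i) ∧ isPlus (sgn a i j e))

-- A clique vector can be read off from its matching vertex by vertex. At i ∈ S, ψ a contains
-- at most one edge, ij or the whisker i w_{i,j}, and in both cases j = a_i; the edge ij of H
-- itself is used exactly when a_i = j, a_j = i and a_{i,j} = −. If ψ a covers i by no edge at
-- all, the whisker towards a_i is missing, so a_i is the smallest neighbour of i (dually, the
-- largest one for vertices of T). This determines a_i, a_j and the signs. Conversely, a matching
-- M is decoded by the same recipe, with a_{i,j} = + exactly when i and j point at each other
-- but ij ∉ M.
module Submission where

open import Defs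
open import Data.Bool using (Bool; true; false; T; _∧_)
open import Data.Bool.ListAction using (any)
open import Data.Bool.Properties using (T-∧; T-≡; T?; T-irrelevant)
open import Data.Empty using (⊥-elim)
open import Data.Fin using (Fin; toℕ; _≟_)
open import Data.Fin.Properties using (toℕ-injective; toℕ<n; any?)
open import Data.List using (_∷_; length; filterᵇ; allFin)
open import Data.List.Membership.Propositional using (lose)
open import Data.List.Membership.Propositional.Properties using (∈-allFin)
open import Data.List.Relation.Unary.Any using (satisfied)
open import Data.List.Relation.Unary.Any.Properties using (any⁺; any⁻)
open import Data.Nat using (ℕ; _<_; _<ᵇ_; _∸_; s≤s; z≤n)
open import Data.Nat.Induction using (<-wellFounded)
open import Data.Nat.Properties using (<ᵇ⇒<; <⇒<ᵇ; <⇒≤; ≤-trans; <-cmp; ∸-monoʳ-<)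
open import Data.Product using (Σ; ∃; _×_; _,_; proj₁; proj₂)
open import Data.Sum using (_⊎_; inj₁; inj₂)
open import Function using (_∘_)
open import Function.Bundles using (Equivalence)
open import Induction.WellFounded using (Acc; acc)
open import Relation.Binary using (tri<; tri≈; tri>)
import Relation.Binary.Construct.On as On
open import Relation.Binary.PropositionalEquality
  using (_≡_; _≢_; _≗_; refl; sym; trans; cong; cong₂; subst)
open import Relation.Nullary using (¬_; yes; no; Dec; contradiction)
open import Relation.Nullary.Decidable using (map′; _×-dec_; _⊎-dec_)

open Equivalence using (to; from)

T-injective : ∀ {x y} → (T x → T y) → (T y → T x) → x ≡ y
T-injective {false} {false} _ _ = refl
T-injective {false} {true}  _ g = contradiction (g _) λ ()
T-injective {true}  {false} f _ = contradiction (f _) λ ()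
T-injective {true}  {true}  _ _ = refl

Σ-T? : ∀ b {P : T b → Set} → (∀ e → Dec (P e)) → Dec (Σ (T b) P)
Σ-T? false P? = no proj₁
Σ-T? true  P? = map′ (_ ,_) proj₂ (P? _)

filterᵇ-nonempty⇒∃ : ∀ {A : Set} (p : A → Bool) xs → 0 < length (filterᵇ p xs) → ∃ (T ∘ p)
filterᵇ-nonempty⇒∃ p (x ∷ xs) lt with p x in px
... | true  = x , from T-≡ px
... | false = filterᵇ-nonempty⇒∃ p xs lt

-- hasSmallerNbrS adj i and hasLargerNbrT adj j are definitionally
-- hasSmaller (adj i) and hasLarger (λ i → adj i j).
module Extremal {k : ℕ} (p : Fin k → Bool) where

  hasSmaller : Fin k → Bool
  hasSmaller x = any (λ y → (toℕ y <ᵇ toℕ x) ∧ p y) (allFin k)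

  hasLarger : Fin k → Bool
  hasLarger x = any (λ y → (toℕ x <ᵇ toℕ y) ∧ p y) (allFin k)

  private
    any-allFin⁺ : ∀ (f : Fin k → Bool) y → T (f y) → T (any f (allFin k))
    any-allFin⁺ f y fy = any⁺ f (lose (∈-allFin y) fy)

    any-allFin⁻ : ∀ (f : Fin k → Bool) → T (any f (allFin k)) → ∃ (T ∘ f)
    any-allFin⁻ f = satisfied ∘ any⁻ f (allFin k)

  hasSmaller⁺ : ∀ {x y} → toℕ y < toℕ x → T (p y) → T (hasSmaller x)
  hasSmaller⁺ {x} {y} y<x py = any-allFin⁺ _ y (from T-∧ (<⇒<ᵇ y<x , py))

  hasSmaller⁻ : ∀ {x} → T (hasSmaller x) → ∃ λ y → toℕ y < toℕ x × T (p y)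
  hasSmaller⁻ s with y , t ← any-allFin⁻ _ s with y<x , py ← to T-∧ t =
    y , <ᵇ⇒< _ _ y<x , py

  hasLarger⁺ : ∀ {x y} → toℕ x < toℕ y → T (p y) → T (hasLarger x)
  hasLarger⁺ {x} {y} x<y py = any-allFin⁺ _ y (from T-∧ (<⇒<ᵇ x<y , py))

  hasLarger⁻ : ∀ {x} → T (hasLarger x) → ∃ λ y → toℕ x < toℕ y × T (p y)
  hasLarger⁻ s with y , t ← any-allFin⁻ _ s with x<y , py ← to T-∧ t =
    y , <ᵇ⇒< _ _ x<y , py

  minimal-unique : ∀ {x y} → T (p x) → T (p y) →
                   ¬ T (hasSmaller x) → ¬ T (hasSmaller y) → x ≡ y
  minimal-unique {x} {y} px py ¬sx ¬sy with <-cmp (toℕ x) (toℕ y)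
  ... | tri< x<y _ _ = contradiction (hasSmaller⁺ x<y px) ¬sy
  ... | tri≈ _ x≡y _ = toℕ-injective x≡y
  ... | tri> _ _ y<x = contradiction (hasSmaller⁺ y<x py) ¬sx

  maximal-unique : ∀ {x y} → T (p x) → T (p y) →
                   ¬ T (hasLarger x) → ¬ T (hasLarger y) → x ≡ y
  maximal-unique {x} {y} px py ¬lx ¬ly with <-cmp (toℕ x) (toℕ y)
  ... | tri< x<y _ _ = contradiction (hasLarger⁺ x<y py) ¬lx
  ... | tri≈ _ x≡y _ = toℕ-injective x≡y
  ... | tri> _ _ y<x = contradiction (hasLarger⁺ y<x px) ¬ly

  private
    _≺_ _≻_ : Fin k → Fin k → Set
    y ≺ x = toℕ y < toℕ x
    y ≻ x = k ∸ toℕ y < k ∸ toℕ x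

    minimal-from : ∀ {x} → Acc _≺_ x → T (p x) → ∃ λ y → T (p y) × ¬ T (hasSmaller y)
    minimal-from {x} (acc rs) px with T? (hasSmaller x)
    ... | no ¬s = x , px , ¬s
    ... | yes s with y , y<x , py ← hasSmaller⁻ s = minimal-from (rs y<x) py

    maximal-from : ∀ {x} → Acc _≻_ x → T (p x) → ∃ λ y → T (p y) × ¬ T (hasLarger y)
    maximal-from {x} (acc rs) px with T? (hasLarger x)
    ... | no ¬l = x , px , ¬l
    ... | yes l with y , x<y , py ← hasLarger⁻ l =
      maximal-from (rs (∸-monoʳ-< x<y (<⇒≤ (toℕ<n y)))) py

  minimal-exists : ∀ {x} → T (p x) → ∃ λ y → T (p y) × ¬ T (hasSmaller y)
  minimal-exists = minimal-from (On.wellFounded toℕ <-wellFounded _)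

  maximal-exists : ∀ {x} → T (p x) → ∃ λ y → T (p y) × ¬ T (hasLarger y)
  maximal-exists = maximal-from (On.wellFounded (λ y → k ∸ toℕ y) <-wellFounded _)

module MatchingMap {n m : ℕ} (adj : BipAdj n m) where

  open Extremal using (minimal-unique; maximal-unique; minimal-exists; maximal-exists)

  plus≢minus : _≢_ {A = Sign adj} plus minus
  plus≢minus ()

  ≡minus? : (s : Sign adj) → Dec (s ≡ minus)
  ≡minus? plus  = no plus≢minus
  ≡minus? minus = yes refl

  Sign-ext : {s t : Sign adj} → (s ≡ plus → t ≡ plus) → (t ≡ plus → s ≡ plus) → s ≡ t
  Sign-ext {plus}  {plus}  _ _ = refl
  Sign-ext {plus}  {minus} f _ = sym (f refl)
  Sign-ext {minus} {plus}  _ g = g refl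
  Sign-ext {minus} {minus} _ _ = refl

  hE-cong : ∀ {i i′ j j′} {e : T (adj i j)} {e′ : T (adj i′ j′)} →
            i ≡ i′ → j ≡ j′ → _≡_ {A = WEdge adj} (hE i j e) (hE i′ j′ e′)
  hE-cong refl refl = cong (hE _ _) (T-irrelevant _ _)

  wsE-cong : ∀ {i j j′} {e : T (adj i j)} {e′ : T (adj i j′)} {h h′} →
             j ≡ j′ → _≡_ {A = WEdge adj} (wsE i j e h) (wsE i j′ e′ h′)
  wsE-cong refl = cong₂ (wsE _ _) (T-irrelevant _ _) (T-irrelevant _ _)

  wtE-cong : ∀ {i i′ j} {e : T (adj i j)} {e′ : T (adj i′ j)} {h h′} →
             i ≡ i′ → _≡_ {A = WEdge adj} (wtE j i e h) (wtE j i′ e′ h′)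
  wtE-cong refl = cong₂ (wtE _ _) (T-irrelevant _ _) (T-irrelevant _ _)

  hE-injective : ∀ {i i′ j j′} {e : T (adj i j)} {e′ : T (adj i′ j′)} →
                 _≡_ {A = WEdge adj} (hE i j e) (hE i′ j′ e′) → i ≡ i′ × j ≡ j′
  hE-injective refl = refl , refl

  wsE-injective : ∀ {i i′ j j′} {e : T (adj i j)} {e′ : T (adj i′ j′)} {h h′} →
                  _≡_ {A = WEdge adj} (wsE i j e h) (wsE i′ j′ e′ h′) → i ≡ i′ × j ≡ j′
  wsE-injective refl = refl , refl

  wtE-injective : ∀ {i i′ j j′} {e : T (adj i j)} {e′ : T (adj i′ j′)} {h h′} →
                  _≡_ {A = WEdge adj} (wtE j i e h) (wtE j′ i′ e′ h′) → i ≡ i′ × j ≡ j′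
  wtE-injective refl = refl , refl

  Joined : CliqueVec adj → ∀ {i j} → T (adj i j) → Set
  Joined a {i} {j} e = aS a i ≡ j × aT a j ≡ i × sgn a i j e ≡ minus

  joined? : ∀ a {i j} (e : T (adj i j)) → Dec (Joined a e)
  joined? a {i} {j} e = aS a i ≟ j ×-dec aT a j ≟ i ×-dec ≡minus? (sgn a i j e)

  Joined-resp : ∀ a {i i′ j j′} {e : T (adj i j)} {e′ : T (adj i′ j′)} →
                i ≡ i′ → j ≡ j′ → Joined a e → Joined a e′
  Joined-resp a {i} {j = j} {e = e} refl refl (p , q , s) =
    p , q , trans (cong (sgn a i j) (T-irrelevant _ e)) s

  module _ (a : CliqueVec adj) {i : Fin n} {j : Fin m} (e : T (adj i j)) where

    ψ-hE⁺ : Joined a e → T (ψ adj a (hE i j e))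
    ψ-hE⁺ (p , q , s) with aS a i ≟ j | aT a j ≟ i | sgn a i j e
    ψ-hE⁺ (p , q , ()) | yes _ | yes _ | plus
    ... | yes _ | yes _ | minus = _
    ... | no ¬p | _     | _     = contradiction p ¬p
    ... | yes _ | no ¬q | _     = contradiction q ¬q

    ψ-hE⁻ : T (ψ adj a (hE i j e)) → Joined a e
    ψ-hE⁻ t with aS a i ≟ j | aT a j ≟ i | sgn a i j e
    ... | yes p | yes q | minus = p , q , refl

    ψ-wsE⁺ : ∀ h → aS a i ≡ j → ¬ Joined a e → T (ψ adj a (wsE i j e h))
    ψ-wsE⁺ _ p ¬J with aS a i ≟ j | aT a j ≟ i | sgn a i j e
    ... | no ¬p | _     | _     = contradiction p ¬p
    ... | yes _ | no _  | _     = _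
    ... | yes _ | yes _ | plus  = _
    ... | yes p | yes q | minus = contradiction (p , q , refl) ¬J

    ψ-wsE⁻ : ∀ h → T (ψ adj a (wsE i j e h)) → aS a i ≡ j × ¬ Joined a e
    ψ-wsE⁻ _ t with aS a i ≟ j | aT a j ≟ i | sgn a i j e
    ... | yes p | no ¬q | _    = p , ¬q ∘ proj₁ ∘ proj₂
    ... | yes p | yes _ | plus = p , λ (_ , _ , s) → plus≢minus s

    ψ-wtE⁺ : ∀ h → aT a j ≡ i → ¬ Joined a e → T (ψ adj a (wtE j i e h))
    ψ-wtE⁺ _ q ¬J with aS a i ≟ j | aT a j ≟ i | sgn a i j e
    ... | _     | no ¬q | _     = contradiction q ¬q
    ... | no _  | yes _ | _     = _
    ... | yes _ | yes _ | plus  = _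
    ... | yes p | yes q | minus = contradiction (p , q , refl) ¬J

    ψ-wtE⁻ : ∀ h → T (ψ adj a (wtE j i e h)) → aT a j ≡ i × ¬ Joined a e
    ψ-wtE⁻ _ t with aS a i ≟ j | aT a j ≟ i | sgn a i j e
    ... | no ¬p | yes q | _    = q , ¬p ∘ proj₁
    ... | yes _ | yes q | plus = q , λ (_ , _ , s) → plus≢minus s

  ψ-hE-wsE-clash : ∀ a {i j j′} (e : T (adj i j)) (e′ : T (adj i j′)) h →
                   T (ψ adj a (hE i j e)) → ¬ T (ψ adj a (wsE i j′ e′ h))
  ψ-hE-wsE-clash a e e′ h x y
    with J@(p , _) ← ψ-hE⁻ a e x | p′ , ¬J′ ← ψ-wsE⁻ a e′ h y =
    ¬J′ (Joined-resp a refl (trans (sym p) p′) J)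

  ψ-hE-wtE-clash : ∀ a {i i′ j} (e : T (adj i j)) (e′ : T (adj i′ j)) h →
                   T (ψ adj a (hE i j e)) → ¬ T (ψ adj a (wtE j i′ e′ h))
  ψ-hE-wtE-clash a e e′ h x y
    with J@(_ , q , _) ← ψ-hE⁻ a e x | q′ , ¬J′ ← ψ-wtE⁻ a e′ h y =
    ¬J′ (Joined-resp a (trans (sym q) q′) refl J)

  ψ-isMatching : (a : CliqueVec adj) → IsMatching adj (ψ adj a)
  ψ-isMatching a _ _ _ x y (hE-s {e = e}) (hE-s {e = e′}) =
    hE-cong refl (trans (sym (proj₁ (ψ-hE⁻ a e x))) (proj₁ (ψ-hE⁻ a e′ y)))
  ψ-isMatching a _ _ _ x y (hE-t {e = e}) (hE-t {e = e′}) =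
    hE-cong (trans (sym (proj₁ (proj₂ (ψ-hE⁻ a e x)))) (proj₁ (proj₂ (ψ-hE⁻ a e′ y)))) refl
  ψ-isMatching a _ _ _ x y (wsE-s {e = e} {h}) (wsE-s {e = e′} {h′}) =
    wsE-cong (trans (sym (proj₁ (ψ-wsE⁻ a e h x))) (proj₁ (ψ-wsE⁻ a e′ h′ y)))
  ψ-isMatching a _ _ _ x y (wtE-t {e = e} {h}) (wtE-t {e = e′} {h′}) =
    wtE-cong (trans (sym (proj₁ (ψ-wtE⁻ a e h x))) (proj₁ (ψ-wtE⁻ a e′ h′ y)))
  ψ-isMatching a _ _ _ x y (hE-s {e = e}) (wsE-s {e = e′} {h}) = ⊥-elim (ψ-hE-wsE-clash a e e′ h x y)
  ψ-isMatching a _ _ _ x y (wsE-s {e = e′} {h}) (hE-s {e = e}) = ⊥-elim (ψ-hE-wsE-clash a e e′ h y x)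
  ψ-isMatching a _ _ _ x y (hE-t {e = e}) (wtE-t {e = e′} {h}) = ⊥-elim (ψ-hE-wtE-clash a e e′ h x y)
  ψ-isMatching a _ _ _ x y (wtE-t {e = e′} {h}) (hE-t {e = e}) = ⊥-elim (ψ-hE-wtE-clash a e e′ h y x)
  ψ-isMatching a _ _ _ x y wsE-w wsE-w = wsE-cong refl
  ψ-isMatching a _ _ _ x y wtE-w wtE-w = wtE-cong refl

  TowardS : EdgeSet adj → Fin n → Fin m → Set
  TowardS M i j = Σ (T (adj i j)) λ e →
    T (M (hE i j e)) ⊎ Σ (T (hasSmallerNbrS adj i j)) λ h → T (M (wsE i j e h))

  TowardT : EdgeSet adj → Fin m → Fin n → Set
  TowardT M j i = Σ (T (adj i j)) λ e →
    T (M (hE i j e)) ⊎ Σ (T (hasLargerNbrT adj j i)) λ h → T (M (wtE j i e h))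

  towardS? : ∀ M i j → Dec (TowardS M i j)
  towardS? M i j = Σ-T? (adj i j) λ _ → T? _ ⊎-dec Σ-T? (hasSmallerNbrS adj i j) λ _ → T? _

  towardT? : ∀ M j i → Dec (TowardT M j i)
  towardT? M j i = Σ-T? (adj i j) λ _ → T? _ ⊎-dec Σ-T? (hasLargerNbrT adj j i) λ _ → T? _

  towardS-resp : ∀ {M M′} → M ≗ M′ → ∀ {i j} → TowardS M i j → TowardS M′ i j
  towardS-resp M≗M′ (e , inj₁ x)       = e , inj₁ (subst T (M≗M′ _) x)
  towardS-resp M≗M′ (e , inj₂ (h , x)) = e , inj₂ (h , subst T (M≗M′ _) x)

  towardT-resp : ∀ {M M′} → M ≗ M′ → ∀ {j i} → TowardT M j i → TowardT M′ j i
  towardT-resp M≗M′ (e , inj₁ x)       = e , inj₁ (subst T (M≗M′ _) x)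
  towardT-resp M≗M′ (e , inj₂ (h , x)) = e , inj₂ (h , subst T (M≗M′ _) x)

  module _ {M : EdgeSet adj} (isM : IsMatching adj M) where

    towardS-unique : ∀ {i j j′} → TowardS M i j → TowardS M i j′ → j ≡ j′
    towardS-unique (_ , inj₁ x)       (_ , inj₁ y)       =
      proj₂ (hE-injective (isM _ _ _ x y hE-s hE-s))
    towardS-unique (_ , inj₁ x)       (_ , inj₂ (_ , y)) = contradiction (isM _ _ _ x y hE-s wsE-s) λ ()
    towardS-unique (_ , inj₂ (_ , x)) (_ , inj₁ y)       = contradiction (isM _ _ _ x y wsE-s hE-s) λ ()
    towardS-unique (_ , inj₂ (_ , x)) (_ , inj₂ (_ , y)) =
      proj₂ (wsE-injective (isM _ _ _ x y wsE-s wsE-s))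

    towardT-unique : ∀ {j i i′} → TowardT M j i → TowardT M j i′ → i ≡ i′
    towardT-unique (_ , inj₁ x)       (_ , inj₁ y)       =
      proj₁ (hE-injective (isM _ _ _ x y hE-t hE-t))
    towardT-unique (_ , inj₁ x)       (_ , inj₂ (_ , y)) = contradiction (isM _ _ _ x y hE-t wtE-t) λ ()
    towardT-unique (_ , inj₂ (_ , x)) (_ , inj₁ y)       = contradiction (isM _ _ _ x y wtE-t hE-t) λ ()
    towardT-unique (_ , inj₂ (_ , x)) (_ , inj₂ (_ , y)) =
      proj₁ (wtE-injective (isM _ _ _ x y wtE-t wtE-t))

  module _ (a : CliqueVec adj) where

    ψ-towardS⁻ : ∀ {i j} → TowardS (ψ adj a) i j → aS a i ≡ j
    ψ-towardS⁻ (e , inj₁ x)       = proj₁ (ψ-hE⁻ a e x)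
    ψ-towardS⁻ (e , inj₂ (h , x)) = proj₁ (ψ-wsE⁻ a e h x)

    ψ-towardT⁻ : ∀ {j i} → TowardT (ψ adj a) j i → aT a j ≡ i
    ψ-towardT⁻ (e , inj₁ x)       = proj₁ (proj₂ (ψ-hE⁻ a e x))
    ψ-towardT⁻ (e , inj₂ (h , x)) = proj₁ (ψ-wtE⁻ a e h x)

    ψ-towardS⁺ : ∀ {i} → T (hasSmallerNbrS adj i (aS a i)) → TowardS (ψ adj a) i (aS a i)
    ψ-towardS⁺ {i} h with e ← aS-nb a i | joined? a e
    ... | yes J = e , inj₁ (ψ-hE⁺ a e J)
    ... | no ¬J = e , inj₂ (h , ψ-wsE⁺ a e h refl ¬J)

    ψ-towardT⁺ : ∀ {j} → T (hasLargerNbrT adj j (aT a j)) → TowardT (ψ adj a) j (aT a j)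
    ψ-towardT⁺ {j} h with e ← aT-nb a j | joined? a e
    ... | yes J = e , inj₁ (ψ-hE⁺ a e J)
    ... | no ¬J = e , inj₂ (h , ψ-wtE⁺ a e h refl ¬J)

  module _ (a b : CliqueVec adj) (ψa≗ψb : ψ adj a ≗ ψ adj b) where

    aS-determined : ∀ i → aS a i ≡ aS b i
    aS-determined i with T? (hasSmallerNbrS adj i (aS a i)) | T? (hasSmallerNbrS adj i (aS b i))
    ... | yes h | _ = sym (ψ-towardS⁻ b (towardS-resp ψa≗ψb (ψ-towardS⁺ a h)))
    ... | _ | yes h = ψ-towardS⁻ a (towardS-resp (sym ∘ ψa≗ψb) (ψ-towardS⁺ b h))
    ... | no ¬h | no ¬h′ = minimal-unique (adj i) (aS-nb a i) (aS-nb b i) ¬h ¬h′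

    aT-determined : ∀ j → aT a j ≡ aT b j
    aT-determined j with T? (hasLargerNbrT adj j (aT a j)) | T? (hasLargerNbrT adj j (aT b j))
    ... | yes h | _ = sym (ψ-towardT⁻ b (towardT-resp ψa≗ψb (ψ-towardT⁺ a h)))
    ... | _ | yes h = ψ-towardT⁻ a (towardT-resp (sym ∘ ψa≗ψb) (ψ-towardT⁺ b h))
    ... | no ¬h | no ¬h′ = maximal-unique (λ i → adj i j) (aT-nb a j) (aT-nb b j) ¬h ¬h′

    sgn-plus-determined : ∀ {i j} (e : T (adj i j)) → sgn a i j e ≡ plus → sgn b i j e ≡ plus
    sgn-plus-determined {i} {j} e s with sgn b i j e in s′
    ... | plus  = refl
    ... | minus = ⊥-elim (plus≢minus (trans (sym s) (proj₂ (proj₂ Ja))))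
      where
        Jb : Joined b e
        Jb = let p , q = sgn-ok a i j e s in
             trans (sym (aS-determined i)) p , trans (sym (aT-determined j)) q , s′
        Ja : Joined a e
        Ja = ψ-hE⁻ a e (subst T (sym (ψa≗ψb (hE i j e))) (ψ-hE⁺ b e Jb))

  ψ-injective : (a b : CliqueVec adj) → ψ adj a ≗ ψ adj b → _≈V_ adj a b
  ψ-injective a b ψa≗ψb =
      aS-determined a b ψa≗ψb
    , aT-determined a b ψa≗ψb
    , λ i j e → Sign-ext (sgn-plus-determined a b ψa≗ψb e)
                         (sgn-plus-determined b a (sym ∘ ψa≗ψb) e)

  module Decode (nbrS : ∀ i → ∃ λ j → T (adj i j)) (nbrT : ∀ j → ∃ λ i → T (adj i j))
                (M : EdgeSet adj) (isM : IsMatching adj M) where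

    DecodesS : Fin n → Fin m → Set
    DecodesS i j = TowardS M i j ⊎ (¬ ∃ (TowardS M i) × T (adj i j) × ¬ T (hasSmallerNbrS adj i j))

    DecodesT : Fin m → Fin n → Set
    DecodesT j i = TowardT M j i ⊎ (¬ ∃ (TowardT M j) × T (adj i j) × ¬ T (hasLargerNbrT adj j i))

    decodesS-exists : ∀ i → ∃ (DecodesS i)
    decodesS-exists i with any? (towardS? M i)
    ... | yes (j , t) = j , inj₁ t
    ... | no ¬t with j , e , ¬h ← minimal-exists (adj i) (proj₂ (nbrS i)) =
      j , inj₂ (¬t , e , ¬h)

    decodesT-exists : ∀ j → ∃ (DecodesT j)
    decodesT-exists j with any? (towardT? M j)
    ... | yes (i , t) = i , inj₁ t
    ... | no ¬t with i , e , ¬h ← maximal-exists (λ i → adj i j) (proj₂ (nbrT j)) =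
      i , inj₂ (¬t , e , ¬h)

    decS : Fin n → Fin m
    decS i = proj₁ (decodesS-exists i)

    decT : Fin m → Fin n
    decT j = proj₁ (decodesT-exists j)

    decS-adj : ∀ i → T (adj i (decS i))
    decS-adj i with proj₂ (decodesS-exists i)
    ... | inj₁ (e , _)     = e
    ... | inj₂ (_ , e , _) = e

    decT-adj : ∀ j → T (adj (decT j) j)
    decT-adj j with proj₂ (decodesT-exists j)
    ... | inj₁ (e , _)     = e
    ... | inj₂ (_ , e , _) = e

    decS-towardS : ∀ {i j} → TowardS M i j → decS i ≡ j
    decS-towardS t with proj₂ (decodesS-exists _)
    ... | inj₁ t′       = towardS-unique isM t′ t
    ... | inj₂ (¬t , _) = contradiction (_ , t) ¬t

    decT-towardT : ∀ {j i} → TowardT M j i → decT j ≡ i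
    decT-towardT t with proj₂ (decodesT-exists _)
    ... | inj₁ t′       = towardT-unique isM t′ t
    ... | inj₂ (¬t , _) = contradiction (_ , t) ¬t

    decS-whisker : ∀ {i j} {e : T (adj i j)} (h : T (hasSmallerNbrS adj i j)) → decS i ≡ j →
                   ¬ T (M (hE i j e)) → T (M (wsE i j e h))
    decS-whisker h refl ¬x with proj₂ (decodesS-exists _)
    ... | inj₁ (_ , inj₁ x)       = contradiction (subst (T ∘ M) (hE-cong refl refl) x) ¬x
    ... | inj₁ (_ , inj₂ (_ , y)) = subst (T ∘ M) (wsE-cong refl) y
    ... | inj₂ (_ , _ , ¬h)       = contradiction h ¬h

    decT-whisker : ∀ {i j} {e : T (adj i j)} (h : T (hasLargerNbrT adj j i)) → decT j ≡ i →
                   ¬ T (M (hE i j e)) → T (M (wtE j i e h))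
    decT-whisker h refl ¬x with proj₂ (decodesT-exists _)
    ... | inj₁ (_ , inj₁ x)       = contradiction (subst (T ∘ M) (hE-cong refl refl) x) ¬x
    ... | inj₁ (_ , inj₂ (_ , y)) = subst (T ∘ M) (wtE-cong refl) y
    ... | inj₂ (_ , _ , ¬h)       = contradiction h ¬h

    decSgn : ∀ i j → T (adj i j) → Sign adj
    decSgn i j e with T? (M (hE i j e)) | decS i ≟ j | decT j ≟ i
    ... | no _ | yes _ | yes _ = plus
    ... | _    | _     | _     = minus

    decSgn-ok : ∀ i j e → decSgn i j e ≡ plus → decS i ≡ j × decT j ≡ i
    decSgn-ok i j e with T? (M (hE i j e)) | decS i ≟ j | decT j ≟ i
    ... | no _  | yes p | yes q = λ _ → p , q
    ... | yes _ | _     | _     = λ ()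
    ... | no _  | no _  | _     = λ ()
    ... | no _  | yes _ | no _  = λ ()

    decode : CliqueVec adj
    decode = record
      { aS = decS ; aS-nb = decS-adj ; aT = decT ; aT-nb = decT-adj
      ; sgn = decSgn ; sgn-ok = decSgn-ok }

    decode-joined⁺ : ∀ {i j} {e : T (adj i j)} → T (M (hE i j e)) → Joined decode e
    decode-joined⁺ {i} {j} {e} x =
      decS-towardS (e , inj₁ x) , decT-towardT (e , inj₁ x) , decSgn-minus
      where
        decSgn-minus : decSgn i j e ≡ minus
        decSgn-minus with T? (M (hE i j e))
        ... | yes _ = refl
        ... | no ¬x = contradiction x ¬x

    decode-joined⁻ : ∀ {i j} {e : T (adj i j)} → Joined decode e → T (M (hE i j e))
    decode-joined⁻ {i} {j} {e} (p , q , s) with T? (M (hE i j e)) | decS i ≟ j | decT j ≟ i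
    ... | yes x | _     | _     = x
    ... | no _  | yes _ | yes _ = ⊥-elim (plus≢minus s)
    ... | no _  | no ¬p | _     = contradiction p ¬p
    ... | no _  | yes _ | no ¬q = contradiction q ¬q

    ψ-decode : ψ adj decode ≗ M
    ψ-decode (hE i j e) =
      T-injective (decode-joined⁻ ∘ ψ-hE⁻ decode e) (ψ-hE⁺ decode e ∘ decode-joined⁺)
    ψ-decode (wsE i j e h) = T-injective
      (λ y → let p , ¬J = ψ-wsE⁻ decode e h y in decS-whisker h p (¬J ∘ decode-joined⁺))
      (λ y → ψ-wsE⁺ decode e h (decS-towardS (e , inj₂ (h , y)))
               λ J → contradiction (isM _ _ _ (decode-joined⁻ J) y hE-s wsE-s) λ ())
    ψ-decode (wtE j i e h) = T-injective
      (λ y → let q , ¬J = ψ-wtE⁻ decode e h y in decT-whisker h q (¬J ∘ decode-joined⁺))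
      (λ y → ψ-wtE⁺ decode e h (decT-towardT (e , inj₂ (h , y)))
               λ J → contradiction (isM _ _ _ (decode-joined⁻ J) y hE-t wtE-t) λ ())

theorem3p9 : (n m : ℕ) (adj : BipAdj n m) → NoDeg01 adj →
    ((a : CliqueVec adj) → IsMatching adj (ψ adj a))
  × ((a b : CliqueVec adj) → (∀ e → ψ adj a e ≡ ψ adj b e) → _≈V_ adj a b)
  × ((M : EdgeSet adj) → IsMatching adj M →
       Σ (CliqueVec adj) (λ a → ∀ e → ψ adj a e ≡ M e))
theorem3p9 n m adj (2≤degS , 2≤degT) =
  ψ-isMatching , ψ-injective , λ M isM → decode M isM , ψ-decode M isM
  where
    open MatchingMap adj
    -- of the degree bound, only degree ≥ 1 is used
    nbrS : ∀ i → ∃ λ j → T (adj i j)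
    nbrS i = filterᵇ-nonempty⇒∃ (adj i) (allFin m) (≤-trans (s≤s z≤n) (2≤degS i))
    nbrT : ∀ j → ∃ λ i → T (adj i j)
    nbrT j = filterᵇ-nonempty⇒∃ (λ i → adj i j) (allFin n) (≤-trans (s≤s z≤n) (2≤degT j))
    open Decode nbrS nbrT
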